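{- Let $m\ge2$ be an integer and let $(t_n)_{n\ge0}$ be the $TM_m$ sequence. If $m=2$, then $(t_n)_{n\ge0}$ is palindromic. If $m>2$, then $(t_n)_{n\ge0}$ is not eventually palindromic.
   Context: For integers $m\ge2$ and $n\ge0$, write the base-$m$ expansion $n=\sum_{j=0}^{k}c_j m^j$ with digits $c_j\in\{0,\dots,m-1\}$; the $TM_m$ sequence is $t_n:=\left(\sum_{j=0}^{k}c_j\right)\bmod m$. A sequence $(x_i)_{i\ge0}$ is palindromic if there is an increasing sequence of positive integers $(n_j)_{j\ge1}$ such that for every $j$ and every $k\in\{0,\dots,n_j\}$, $x_k=x_{n_j-k}$; it is eventually palindromic if for some $N$ the tail $(x_{N+i})_{i\ge0}$ is palindromic. -}

module Defs where

open import Data.Nat using (ℕ; zero; suc; _+_; _∸_; _≤_; _<_; NonZero)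
open import Data.Nat.DivMod using (_/_; _%_)
open import Relation.Binary.PropositionalEquality using (_≡_)
open import Data.Product using (Σ; _×_; ∃-syntax)

-- Base-m digit sum with fuel; fuel n suffices for m ≥ 2 since n/m < n for n > 0.
digitSumFuel : (m : ℕ) .{{_ : NonZero m}} → ℕ → ℕ → ℕ
digitSumFuel m zero    n = 0
digitSumFuel m (suc f) n = n % m + digitSumFuel m f (n / m)

digitSum : (m : ℕ) .{{_ : NonZero m}} → ℕ → ℕ
digitSum m n = digitSumFuel m n n

TM : (m : ℕ) .{{_ : NonZero m}} → ℕ → ℕ
TM m n = digitSum m n % m

StrictlyIncreasing : (ℕ → ℕ) → Set
StrictlyIncreasing f = ∀ j → f j < f (suc j)

Palindromic : (ℕ → ℕ) → Set
Palindromic x =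
  ∃[ nseq ] (StrictlyIncreasing nseq × (1 ≤ nseq 0) ×
             (∀ j k → k ≤ nseq j → x k ≡ x (nseq j ∸ k)))

EventuallyPalindromic : (ℕ → ℕ) → Set
EventuallyPalindromic x = ∃[ N ] Palindromic (λ i → x (N + i))

{-# OPTIONS --safe #-}
-- For m = 2 take n_j = 2^(2j+2) − 1: adding k and n_j − k produces no carries, so their binary
-- digit sums add up to the even number 2j + 2 and hence have the same parity.
-- For m > 2, t(x+1) ≡ t(x) + 1 (mod m) unless the last digit of x is m − 1. A palindromic window
-- of length at least 3 in a tail gives t(x) = t(y+1) and t(x+1) = t(y) for three mirror pairs
-- (x, y); numbers ending in m − 1 are m ≥ 3 apart, so one of these pairs avoids them, and then
-- 2 ≡ 0 (mod m).
module Submission where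

open import Defs
open import Data.Nat using (ℕ; zero; suc; pred; _<_; _≤_; NonZero; _+_; _∸_; _*_; _^_; z≤n; s≤s; s≤s⁻¹; _≟_; >-nonZero; >-nonZero⁻¹)
open import Data.Nat.Properties
open import Data.Nat.DivMod
open import Data.Nat.Divisibility using (_∣_; divides; n∣m*n; ∣m+n∣m⇒∣n; ∣⇒≤)
open import Data.Nat.Tactic.RingSolver using (solve-∀)
open import Data.Product using (_×_; _,_)
open import Data.Sum using (_⊎_; inj₁; inj₂)
open import Data.Empty using (⊥; ⊥-elim)
open import Function using (_∘_)
open import Relation.Binary.PropositionalEquality
open import Relation.Nullary using (¬_; Dec; yes; no)

open ≡-Reasoning

%-cong-+ˡ : ∀ c {a b} n .{{_ : NonZero n}} → a % n ≡ b % n → (c + a) % n ≡ (c + b) % n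
%-cong-+ˡ c {a} {b} n a≡b = begin
  (c + a) % n          ≡⟨ %-distribˡ-+ c a n ⟩
  (c % n + a % n) % n  ≡⟨ cong (λ r → (c % n + r) % n) a≡b ⟩
  (c % n + b % n) % n  ≡⟨ sym (%-distribˡ-+ c b n) ⟩
  (c + b) % n          ∎

[d+a]%n≡a%n⇒n∣d : ∀ d a n .{{_ : NonZero n}} → (d + a) % n ≡ a % n → n ∣ d
[d+a]%n≡a%n⇒n∣d d a n eq =
  ∣m+n∣m⇒∣n (subst (n ∣_) (sym (+-cancelˡ-≡ (a % n) _ _ same-remainder)) (n∣m*n ((d + a) / n)))
            (n∣m*n (a / n))
  where
  same-remainder : a % n + ((a / n) * n + d) ≡ a % n + ((d + a) / n) * n
  same-remainder = begin
    a % n + ((a / n) * n + d)        ≡⟨ sym (+-assoc (a % n) _ d) ⟩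
    a % n + (a / n) * n + d          ≡⟨ cong (_+ d) (sym (m≡m%n+[m/n]*n a n)) ⟩
    a + d                            ≡⟨ +-comm a d ⟩
    d + a                            ≡⟨ m≡m%n+[m/n]*n (d + a) n ⟩
    (d + a) % n + ((d + a) / n) * n  ≡⟨ cong (_+ ((d + a) / n) * n) eq ⟩
    a % n + ((d + a) / n) * n        ∎

n∣m∧0<m<2n⇒m≡n : ∀ {m n} → 0 < m → m < n + n → n ∣ m → m ≡ n
n∣m∧0<m<2n⇒m≡n () _ (divides zero refl)
n∣m∧0<m<2n⇒m≡n {n = n} _ _ (divides 1 refl) = +-identityʳ n
n∣m∧0<m<2n⇒m≡n {n = n} _ m<2n (divides (suc (suc k)) refl) =
  ⊥-elim (<⇒≱ m<2n (+-monoʳ-≤ n (m≤m+n n (k * n))))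

m+n≡o*2⇒m%2≡n%2 : ∀ a b t → a + b ≡ t * 2 → a % 2 ≡ b % 2
m+n≡o*2⇒m%2≡n%2 a b t a+b≡2t = begin
  a % 2            ≡⟨ sym ([m+kn]%n≡m%n a b 2) ⟩
  (a + b * 2) % 2  ≡⟨ cong (_% 2) (trans (shuffle a b) (cong (b +_) a+b≡2t)) ⟩
  (b + t * 2) % 2  ≡⟨ [m+kn]%n≡m%n b t 2 ⟩
  b % 2            ∎
  where
  shuffle : ∀ a b → a + b * 2 ≡ b + (a + b)
  shuffle = solve-∀

strictlyIncreasing⇒≥id : ∀ {f} → StrictlyIncreasing f → ∀ j → j ≤ f j
strictlyIncreasing⇒≥id f↑ zero    = z≤n
strictlyIncreasing⇒≥id f↑ (suc j) = ≤-trans (s≤s (strictlyIncreasing⇒≥id f↑ j)) (f↑ j)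

module BaseExpansion (m : ℕ) .{{_ : NonZero m}} (1<m : 1 < m) where

  0%m≡0 : 0 % m ≡ 0
  0%m≡0 = m<n⇒m%n≡m (>-nonZero⁻¹ m)

  digitSumFuel-zero : ∀ f → digitSumFuel m f 0 ≡ 0
  digitSumFuel-zero zero    = refl
  digitSumFuel-zero (suc f) =
    cong₂ _+_ 0%m≡0 (trans (cong (digitSumFuel m f) (0/n≡0 m)) (digitSumFuel-zero f))

  quotient-fuel : ∀ n f → n ≤ suc f → n / m ≤ f
  quotient-fuel zero    f _    = subst (_≤ f) (sym (0/n≡0 m)) z≤n
  quotient-fuel (suc n) f n≤1+f = s≤s⁻¹ (≤-trans (m/n<m (suc n) m 1<m) n≤1+f)

  digitSumFuel-irrelevant : ∀ f g n → n ≤ f → n ≤ g → digitSumFuel m f n ≡ digitSumFuel m g n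
  digitSumFuel-irrelevant zero    g       .zero z≤n _   = sym (digitSumFuel-zero g)
  digitSumFuel-irrelevant (suc f) zero    .zero _   z≤n = digitSumFuel-zero (suc f)
  digitSumFuel-irrelevant (suc f) (suc g) n     n≤f n≤g =
    cong (n % m +_) (digitSumFuel-irrelevant f g (n / m) (quotient-fuel n f n≤f) (quotient-fuel n g n≤g))

  digitSum-step : ∀ n → digitSum m n ≡ n % m + digitSum m (n / m)
  digitSum-step zero    = sym (cong₂ _+_ 0%m≡0 (cong (digitSum m) (0/n≡0 m)))
  digitSum-step (suc n) = cong (suc n % m +_)
    (digitSumFuel-irrelevant n (suc n / m) (suc n / m) (quotient-fuel (suc n) n ≤-refl) ≤-refl)

  digitSum-digit+ : ∀ r q → r < m → digitSum m (r + q * m) ≡ r + digitSum m q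
  digitSum-digit+ r q r<m = begin
    digitSum m (r + q * m)                          ≡⟨ digitSum-step (r + q * m) ⟩
    (r + q * m) % m + digitSum m ((r + q * m) / m)  ≡⟨ cong₂ (λ a b → a + digitSum m b) last-digit quotient ⟩
    r + digitSum m q                                ∎
    where
    last-digit : (r + q * m) % m ≡ r
    last-digit = trans ([m+kn]%n≡m%n r q m) (m<n⇒m%n≡m r<m)
    quotient : (r + q * m) / m ≡ q
    quotient = begin
      (r + q * m) / m    ≡⟨ +-distrib-/-∣ʳ r (n∣m*n q) ⟩
      r / m + q * m / m  ≡⟨ cong₂ _+_ (m<n⇒m/n≡0 r<m) (m*n/n≡m q m) ⟩
      q                  ∎

  LastDigitMax : ℕ → Set
  LastDigitMax a = suc (a % m) ≡ m

  lastDigitMax? : ∀ a → Dec (LastDigitMax a)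
  lastDigitMax? a = suc (a % m) ≟ m

  digitSum-suc : ∀ {a} → ¬ LastDigitMax a → digitSum m (suc a) ≡ suc (digitSum m a)
  digitSum-suc {a} no-carry = begin
    digitSum m (suc a)                     ≡⟨ cong (digitSum m ∘ suc) (m≡m%n+[m/n]*n a m) ⟩
    digitSum m (suc (a % m) + (a / m) * m) ≡⟨ digitSum-digit+ (suc (a % m)) (a / m) (≤∧≢⇒< (m%n<n a m) no-carry) ⟩
    suc (a % m + digitSum m (a / m))       ≡⟨ cong suc (sym (digitSum-step a)) ⟩
    suc (digitSum m a)                     ∎

  -- All p digits of c + d = m^p − 1 equal m − 1, which leaves no room for a carry:
  -- each digit of c and the corresponding digit of d add up to m − 1.
  digitSum-complement : ∀ p c d → suc (c + d) ≡ m ^ p → digitSum m c + digitSum m d ≡ p * pred m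
  digitSum-complement zero c d c+d≡0
    rewrite m+n≡0⇒m≡0 c (suc-injective c+d≡0) | m+n≡0⇒n≡0 c (suc-injective c+d≡0) = refl
  digitSum-complement (suc p) c d c+d+1≡m^[1+p] = begin
    digitSum m c + digitSum m d
      ≡⟨ cong₂ _+_ (digitSum-step c) (digitSum-step d) ⟩
    (c % m + digitSum m (c / m)) + (d % m + digitSum m (d / m))
      ≡⟨ regroup (c % m) (digitSum m (c / m)) (d % m) (digitSum m (d / m)) ⟩
    (c % m + d % m) + (digitSum m (c / m) + digitSum m (d / m))
      ≡⟨ cong₂ _+_ (cong pred low-digits) (digitSum-complement p (c / m) (d / m) high-digits) ⟩
    pred m + p * pred m
      ∎
    where
    regroup : ∀ a b x y → (a + b) + (x + y) ≡ (a + x) + (b + y)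
    regroup = solve-∀
    t : ℕ
    t = suc (c % m + d % m)
    Q : ℕ
    Q = c / m + d / m
    split : t + Q * m ≡ m ^ p * m
    split = begin
      t + Q * m
        ≡⟨ expand (c % m) (c / m) (d % m) (d / m) m ⟩
      suc ((c % m + c / m * m) + (d % m + d / m * m))
        ≡⟨ cong₂ (λ a b → suc (a + b)) (sym (m≡m%n+[m/n]*n c m)) (sym (m≡m%n+[m/n]*n d m)) ⟩
      suc (c + d)
        ≡⟨ c+d+1≡m^[1+p] ⟩
      m * m ^ p
        ≡⟨ *-comm m (m ^ p) ⟩
      m ^ p * m
        ∎
      where
      expand : ∀ r q s q′ b → suc (r + s) + (q + q′) * b ≡ suc ((r + q * b) + (s + q′ * b))
      expand = solve-∀
    low-digits : t ≡ m
    low-digits = n∣m∧0<m<2n⇒m≡n (s≤s z≤n) (+-mono-≤-< (m%n<n c m) (m%n<n d m))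
      (∣m+n∣m⇒∣n (subst (m ∣_) (trans (sym split) (+-comm t (Q * m))) (n∣m*n (m ^ p))) (n∣m*n Q))
    high-digits : suc Q ≡ m ^ p
    high-digits = *-cancelʳ-≡ (suc Q) (m ^ p) m (trans (cong (_+ Q * m) (sym low-digits)) split)

module AboveBinary (m : ℕ) .{{_ : NonZero m}} (2<m : 2 < m) where

  1<m : 1 < m
  1<m = <-trans (n<1+n 1) 2<m

  open BaseExpansion m 1<m

  lastDigitMax-apart : ∀ n i d → 0 < d → d < m → LastDigitMax (n + i) → ¬ LastDigitMax (n + (d + i))
  lastDigitMax-apart n i d 0<d d<m max max′ = <⇒≱ d<m (∣⇒≤ {{>-nonZero 0<d}} m∣d)
    where
    m∣d : m ∣ d
    m∣d = [d+a]%n≡a%n⇒n∣d d (n + i) m (begin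
      (d + (n + i)) % m  ≡⟨ cong (_% m) (+-comm d (n + i)) ⟩
      (n + i + d) % m    ≡⟨ cong (_% m) (+-assoc n i d) ⟩
      (n + (i + d)) % m  ≡⟨ cong (λ j → (n + j) % m) (+-comm i d) ⟩
      (n + (d + i)) % m  ≡⟨ suc-injective (trans max′ (sym max)) ⟩
      (n + i) % m        ∎)

  NoLastDigitMax : ℕ → ℕ → Set
  NoLastDigitMax a b = ¬ LastDigitMax a × ¬ LastDigitMax b

  lastDigitMax-apart₁ : ∀ n i → LastDigitMax (n + i) → ¬ LastDigitMax (n + suc i)
  lastDigitMax-apart₁ n i = lastDigitMax-apart n i 1 (s≤s z≤n) 1<m

  lastDigitMax-apart₂ : ∀ n i → LastDigitMax (n + i) → ¬ LastDigitMax (n + suc (suc i))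
  lastDigitMax-apart₂ n i = lastDigitMax-apart n i 2 (s≤s z≤n) 2<m

  noLastDigitMax-among-three : ∀ N l →
    NoLastDigitMax (N + 0) (N + (2 + l)) ⊎ NoLastDigitMax (N + 1) (N + (1 + l)) ⊎ NoLastDigitMax (N + 2) (N + l)
  noLastDigitMax-among-three N l with lastDigitMax? (N + 0) | lastDigitMax? (N + (2 + l))
  ... | no ¬max₀ | no ¬max₂₊ₗ = inj₁ (¬max₀ , ¬max₂₊ₗ)
  ... | yes max₀ | _ with lastDigitMax? (N + (1 + l))
  ...   | no ¬max₁₊ₗ = inj₂ (inj₁ (lastDigitMax-apart₁ N 0 max₀ , ¬max₁₊ₗ))
  ...   | yes max₁₊ₗ = inj₂ (inj₂ (lastDigitMax-apart₂ N 0 max₀ , λ maxₗ → lastDigitMax-apart₁ N l maxₗ max₁₊ₗ))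
  noLastDigitMax-among-three N l | no ¬max₀ | yes max₂₊ₗ with lastDigitMax? (N + 1)
  ...   | no ¬max₁ = inj₂ (inj₁ (¬max₁ , λ max₁₊ₗ → lastDigitMax-apart₁ N (1 + l) max₁₊ₗ max₂₊ₗ))
  ...   | yes max₁ = inj₂ (inj₂ (lastDigitMax-apart₁ N 1 max₁ , λ maxₗ → lastDigitMax-apart₂ N l maxₗ max₂₊ₗ))

  no-crossed-successors : ∀ {x y} → ¬ LastDigitMax x → ¬ LastDigitMax y →
    TM m x ≡ TM m (suc y) → TM m (suc x) ≡ TM m y → ⊥
  no-crossed-successors {x} {y} ¬max-x ¬max-y tx≡ty₊₁ tx₊₁≡ty = <⇒≱ 2<m (∣⇒≤ m∣2)
    where
    a b : ℕ
    a = digitSum m x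
    b = digitSum m y
    m∣2 : m ∣ 2
    m∣2 = [d+a]%n≡a%n⇒n∣d 2 b m (begin
      (2 + b) % m    ≡⟨ %-cong-+ˡ 1 m (trans (cong (_% m) (sym (digitSum-suc ¬max-y))) (sym tx≡ty₊₁)) ⟩
      (1 + a) % m    ≡⟨ cong (_% m) (sym (digitSum-suc ¬max-x)) ⟩
      TM m (suc x)   ≡⟨ tx₊₁≡ty ⟩
      b % m          ∎)

  palindromic-window-crossing : ∀ N L k → k ≤ L → NoLastDigitMax (N + k) (N + (L ∸ k)) →
    ¬ (∀ i → i ≤ suc L → TM m (N + i) ≡ TM m (N + (suc L ∸ i)))
  palindromic-window-crossing N L k k≤L (¬max-left , ¬max-right) pal =
    no-crossed-successors ¬max-left ¬max-right
      (trans (pal k (m≤n⇒m≤1+n k≤L)) (cong (TM m) (trans (cong (N +_) (+-∸-assoc 1 k≤L)) (+-suc N (L ∸ k)))))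
      (trans (cong (TM m) (sym (+-suc N k))) (pal (suc k) (s≤s k≤L)))

  no-long-palindromic-window : ∀ N {L} → 3 ≤ L → ¬ (∀ i → i ≤ L → TM m (N + i) ≡ TM m (N + (L ∸ i)))
  no-long-palindromic-window N (s≤s (s≤s (s≤s {n = l} _))) pal with noLastDigitMax-among-three N l
  ... | inj₁ no-max        = palindromic-window-crossing N (2 + l) 0 z≤n no-max pal
  ... | inj₂ (inj₁ no-max) = palindromic-window-crossing N (2 + l) 1 (s≤s z≤n) no-max pal
  ... | inj₂ (inj₂ no-max) = palindromic-window-crossing N (2 + l) 2 (s≤s (s≤s z≤n)) no-max pal

  TM-not-eventuallyPalindromic : ¬ EventuallyPalindromic (TM m)
  TM-not-eventuallyPalindromic (N , n , n↑ , _ , pal) =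
    no-long-palindromic-window N (strictlyIncreasing⇒≥id n↑ 3) (pal 3)

TM₂-palindromic : Palindromic (TM 2)
TM₂-palindromic = n , n↑ , s≤s z≤n , reflection
  where
  open BaseExpansion 2 (n<1+n 1)
  e : ℕ → ℕ
  e j = suc j * 2
  n : ℕ → ℕ
  n j = 2 ^ e j ∸ 1
  n↑ : StrictlyIncreasing n
  n↑ j = ∸-monoˡ-< (^-monoʳ-< 2 (n<1+n 1) (*-monoˡ-< 2 (n<1+n (suc j)))) (m^n>0 2 (e j))
  reflection : ∀ j k → k ≤ n j → TM 2 k ≡ TM 2 (n j ∸ k)
  reflection j k k≤n = m+n≡o*2⇒m%2≡n%2 (digitSum 2 k) (digitSum 2 (n j ∸ k)) (suc j)
    (trans (digitSum-complement (e j) k (n j ∸ k) k+[n∸k]+1≡2^e) (*-identityʳ (e j)))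
    where
    k+[n∸k]+1≡2^e : suc (k + (n j ∸ k)) ≡ 2 ^ e j
    k+[n∸k]+1≡2^e = trans (cong suc (m+[n∸m]≡n k≤n)) (m+[n∸m]≡n (m^n>0 2 (e j)))

theorem2p2 : (m : ℕ) .{{_ : NonZero m}} → 2 ≤ m →
    ((m ≡ 2 → Palindromic (TM m)) × (2 < m → ¬ EventuallyPalindromic (TM m)))
theorem2p2 m _ = (λ { refl → TM₂-palindromic }) , AboveBinary.TM-not-eventuallyPalindromic m
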